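{- Let $G$ be a signed graph with vertices $v_1,\dots,v_n$, and let $H_1,\dots,H_n$ be co-regular signed graphs, each of order $m$, with common co-regularity pair $(r,k)$. Then $$f_{L(G\circ\Lambda_{l=1}^{n}H_l)}(\alpha)=\Big(\prod_{l=1}^{n}f_{L(H_l)}(\alpha-1)\Big)\cdot f_{L(G)}\Big(\alpha-m-\frac{m}{\alpha-1-2d^- }\Big),$$ where $d^-$ is the negative degree of any vertex of any $H_l$ $(1\le l\le n)$.
   Context: A signed graph $G=(V,E,\sigma)$ is a finite simple graph with signature $\sigma:E\to\{+1,-1\}$, considered with its canonical marking $\mu(v)=\prod_{e\ni v}\sigma(e)$ (product over incident edges; empty product $=+1$). $d^+(v),d^-(v)$ are the numbers of positive and negative edges at $v$; a signed graph is co-regular with co-regularity pair $(r,k)$ if its underlying graph is $r$-regular and $d^+(v)-d^-(v)=k$ for all $v$. $A(G)$ is the signed adjacency matrix, $\Delta(G)$ the diagonal matrix of unsigned degrees, $L(G)=\Delta(G)-A(G)$ and $f_{L(G)}(\alpha)=\det(\alpha I-L(G))$. Generalized corona product: $G\circ\Lambda_{l=1}^{n}H_l$ is obtained from the disjoint union of $G,H_1,\dots,H_n$ by adding, for each $l$, an edge from $v_l$ to every vertex $w$ of $H_l$ with sign $\mu(v_l)\mu_l(w)$, where $\mu,\mu_l$ are the canonical markings of $G,H_l$. -}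

module Defs where

open import Data.Nat as ℕ using (ℕ; zero; suc)
open import Data.Integer as ℤ using (ℤ; +_; -[1+_])
open import Data.Rational as ℚ using (ℚ; 0ℚ; 1ℚ)
open import Data.Fin using (Fin; zero; suc; punchIn; splitAt; remQuot; _≟_)
open import Data.Sum using (_⊎_; inj₁; inj₂)
open import Data.Product using (_×_; _,_)
open import Relation.Nullary using (yes; no)
open import Relation.Binary.PropositionalEquality using (_≡_)

sumℤ : ∀ {n} → (Fin n → ℤ) → ℤ
sumℤ {zero} f = + 0
sumℤ {suc n} f = f zero ℤ.+ sumℤ (λ i → f (suc i))

prodℤ : ∀ {n} → (Fin n → ℤ) → ℤ
prodℤ {zero} f = + 1
prodℤ {suc n} f = f zero ℤ.* prodℤ (λ i → f (suc i))

prodℚ : ∀ {n} → (Fin n → ℚ) → ℚ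
prodℚ {zero} f = 1ℚ
prodℚ {suc n} f = f zero ℚ.* prodℚ (λ i → f (suc i))

data SignEntry : ℤ → Set where
  none : SignEntry (+ 0)
  pos  : SignEntry (+ 1)
  neg  : SignEntry (-[1+ 0 ])

record SignedGraph (n : ℕ) : Set where
  field
    A       : Fin n → Fin n → ℤ
    entry   : ∀ i j → SignEntry (A i j)
    symm    : ∀ i j → A i j ≡ A j i
    noLoops : ∀ i → A i i ≡ + 0
open SignedGraph public

isEdge : ℤ → ℕ
isEdge (+ 0) = 0
isEdge _ = 1

isPos : ℤ → ℕ
isPos (+ 1) = 1
isPos _ = 0

isNeg : ℤ → ℕ
isNeg (-[1+ 0 ]) = 1
isNeg _ = 0

sumℕ : ∀ {n} → (Fin n → ℕ) → ℕ
sumℕ {zero} f = 0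
sumℕ {suc n} f = f zero ℕ.+ sumℕ (λ i → f (suc i))

deg : ∀ {n} → SignedGraph n → Fin n → ℕ
deg G v = sumℕ (λ w → isEdge (A G v w))

deg⁺ : ∀ {n} → SignedGraph n → Fin n → ℕ
deg⁺ G v = sumℕ (λ w → isPos (A G v w))

deg⁻ : ∀ {n} → SignedGraph n → Fin n → ℕ
deg⁻ G v = sumℕ (λ w → isNeg (A G v w))

edgeFactor : ℤ → ℤ
edgeFactor (+ 0) = + 1
edgeFactor a = a

marking : ∀ {n} → SignedGraph n → Fin n → ℤ
marking G v = prodℤ (λ w → edgeFactor (A G v w))

CoRegular : ∀ {n} → SignedGraph n → ℕ → ℤ → Set
CoRegular G r k = ∀ v → (deg G v ≡ r) × ((+ deg⁺ G v) ℤ.- (+ deg⁻ G v) ≡ k)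

degM : ∀ {n} → (Fin n → Fin n → ℤ) → Fin n → ℕ
degM M v = sumℕ (λ w → isEdge (M v w))

laplacianM : ∀ {n} → (Fin n → Fin n → ℤ) → Fin n → Fin n → ℤ
laplacianM M i j with i ≟ j
... | yes _ = (+ degM M i) ℤ.- M i j
... | no  _ = ℤ.- M i j

laplacian : ∀ {n} → SignedGraph n → Fin n → Fin n → ℤ
laplacian G = laplacianM (A G)

altSum : ∀ {n} → (Fin n → ℚ) → ℚ
altSum {zero} f = 0ℚ
altSum {suc n} f = f zero ℚ.- altSum (λ i → f (suc i))

det : ∀ {n} → (Fin n → Fin n → ℚ) → ℚ
det {zero} M = 1ℚ
det {suc n} M = altSum (λ j → M zero j ℚ.* det (λ i j' → M (suc i) (punchIn j j')))

charLM : ∀ {n} → (Fin n → Fin n → ℤ) → ℚ → ℚ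
charLM {n} A' α = det M
  where
    M : Fin n → Fin n → ℚ
    M i j with i ≟ j
    ... | yes _ = α ℚ.- (laplacianM A' i j ℚ./ 1)
    ... | no  _ = ℚ.- (laplacianM A' i j ℚ./ 1)

charL : ∀ {n} → SignedGraph n → ℚ → ℚ
charL G = charLM (A G)

-- Generalized corona product G ∘ Λ_{l} H_l.
-- Vertex set Fin (n + n * m): first the vertices of G, then the block
-- (l , w) ↦ vertex w of H_l (via remQuot).
coronaA : ∀ {n m} → SignedGraph n → (Fin n → SignedGraph m) →
          Fin (n ℕ.+ n ℕ.* m) → Fin (n ℕ.+ n ℕ.* m) → ℤ
coronaA {n} {m} G H x y with splitAt n x | splitAt n y
... | inj₁ i | inj₁ j = A G i j
... | inj₁ i | inj₂ q with remQuot {n} m q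
...   | (l , w) with i ≟ l
...     | yes _ = marking G i ℤ.* marking (H l) w
...     | no  _ = + 0
coronaA {n} {m} G H x y | inj₂ p | inj₁ j with remQuot {n} m p
...   | (l , w) with j ≟ l
...     | yes _ = marking G j ℤ.* marking (H l) w
...     | no  _ = + 0
coronaA {n} {m} G H x y | inj₂ p | inj₂ q with remQuot {n} m p | remQuot {n} m q
...   | (l , w) | (l' , w') with l ≟ l'
...     | yes _ = A (H l) w w'
...     | no  _ = + 0

-- Order the vertices of the corona as v₁, …, vₙ followed by the blocks H₁, …, Hₙ. Since d⁻ is
-- constant, every vertex of H_l has marking (−1)^d⁻, so v_l is joined to all of H_l by edges of
-- one sign c_l = ±1; and the diagonal block of αI − L at H_l is (α − 1)I − L(H_l), the corona
-- adding one to each degree, whose columns all sum to β = α − 1 − 2d⁻. Subtracting c_l/β times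
-- the rows of block l from the row of v_l therefore clears the upper right block and turns the
-- upper left block into (α − m − m/β)I − L(G). What remains is block triangular with a block
-- diagonal lower part.
module Submission where

open import Defs
open import Data.Nat as ℕ using (ℕ; zero; suc)
import Data.Nat.Properties as ℕP
open import Data.Integer as ℤ using (ℤ; +_; -[1+_]; -1ℤ)
import Data.Integer.Properties as ℤP
open import Data.Rational using (ℚ; 0ℚ; 1ℚ; ½; _+_; _-_; _*_; -_; _÷_; _/_; 1/_; mkℚ; ≢-nonZero)
import Data.Rational.Properties as ℚP
open import Data.Rational.Solver using (module +-*-Solver)
import Data.Nat.Coprimality as Coprime
open import Data.Fin using (Fin; zero; suc; punchIn; lift; _↑ˡ_; _↑ʳ_; combine; remQuot; quotRem; splitAt; _≟_)
open import Data.Fin.Properties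
  using (suc-injective; ↑ˡ-injective; ↑ʳ-injective; splitAt-↑ˡ; splitAt-↑ʳ; combine-remQuot; remQuot-combine; combine-injective)
open import Data.Product using (_×_; _,_; proj₁; proj₂; Σ; swap)
open import Data.Sum using (_⊎_; inj₁; inj₂)
open import Data.Empty using (⊥-elim)
open import Function using (_∘_)
open import Relation.Nullary using (Dec; yes; no)
open import Relation.Binary.PropositionalEquality

open +-*-Solver

sumℚ : ∀ {n} → (Fin n → ℚ) → ℚ
sumℚ {zero} f = 0ℚ
sumℚ {suc n} f = f zero + sumℚ (λ i → f (suc i))

sumℕ-cong : ∀ {k} {f g : Fin k → ℕ} → (∀ i → f i ≡ g i) → sumℕ f ≡ sumℕ g
sumℕ-cong {zero} f≗g = refl
sumℕ-cong {suc k} f≗g = cong₂ ℕ._+_ (f≗g zero) (sumℕ-cong (λ i → f≗g (suc i)))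

sumℕ-zero : ∀ {k} (f : Fin k → ℕ) → (∀ i → f i ≡ 0) → sumℕ f ≡ 0
sumℕ-zero {zero} f f≗0 = refl
sumℕ-zero {suc k} f f≗0 = cong₂ ℕ._+_ (f≗0 zero) (sumℕ-zero (λ i → f (suc i)) (λ i → f≗0 (suc i)))

sumℕ-single : ∀ {k} (i : Fin k) (f : Fin k → ℕ) → (∀ j → j ≢ i → f j ≡ 0) → sumℕ f ≡ f i
sumℕ-single zero f off = trans (cong (f zero ℕ.+_) (sumℕ-zero _ (λ j → off (suc j) (λ ())))) (ℕP.+-identityʳ (f zero))
sumℕ-single (suc i) f off = trans (cong (ℕ._+ sumℕ (λ j → f (suc j))) (off zero (λ ())))
  (sumℕ-single i (λ j → f (suc j)) (λ j j≢i → off (suc j) (j≢i ∘ suc-injective)))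


sumℕ-ones : ∀ k (f : Fin k → ℕ) → (∀ i → f i ≡ 1) → sumℕ f ≡ k
sumℕ-ones zero f f≗1 = refl
sumℕ-ones (suc k) f f≗1 = cong₂ ℕ._+_ (f≗1 zero) (sumℕ-ones k (λ i → f (suc i)) (λ i → f≗1 (suc i)))

sumℕ-↑ : ∀ a {b} (f : Fin (a ℕ.+ b) → ℕ) → sumℕ f ≡ sumℕ (λ i → f (i ↑ˡ b)) ℕ.+ sumℕ (λ q → f (a ↑ʳ q))
sumℕ-↑ zero f = refl
sumℕ-↑ (suc a) f = trans (cong (f zero ℕ.+_) (sumℕ-↑ a (λ i → f (suc i)))) (sym (ℕP.+-assoc (f zero) _ _))

sumℕ-combine : ∀ n {m} (f : Fin (n ℕ.* m) → ℕ) → sumℕ f ≡ sumℕ (λ l → sumℕ (λ w → f (combine {n} {m} l w)))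
sumℕ-combine zero f = refl
sumℕ-combine (suc n) {m} f =
  trans (sumℕ-↑ m f) (cong (sumℕ (λ w → f (w ↑ˡ (n ℕ.* m))) ℕ.+_) (sumℕ-combine n (λ q → f (m ↑ʳ q))))

sumℚ-cong : ∀ {k} {f g : Fin k → ℚ} → (∀ i → f i ≡ g i) → sumℚ f ≡ sumℚ g
sumℚ-cong {zero} f≗g = refl
sumℚ-cong {suc k} f≗g = cong₂ _+_ (f≗g zero) (sumℚ-cong (λ i → f≗g (suc i)))

sumℚ-+ : ∀ {k} (f g : Fin k → ℚ) → sumℚ (λ i → f i + g i) ≡ sumℚ f + sumℚ g
sumℚ-+ {zero} f g = refl
sumℚ-+ {suc k} f g = trans (cong (_+_ (f zero + g zero)) (sumℚ-+ (λ i → f (suc i)) (λ i → g (suc i))))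
  (solve 4 (λ a b c d → (a :+ b) :+ (c :+ d) := (a :+ c) :+ (b :+ d)) refl (f zero) (g zero) _ _)

sumℚ-- : ∀ {k} (f g : Fin k → ℚ) → sumℚ (λ i → f i - g i) ≡ sumℚ f - sumℚ g
sumℚ-- {zero} f g = refl
sumℚ-- {suc k} f g = trans (cong (_+_ (f zero - g zero)) (sumℚ-- (λ i → f (suc i)) (λ i → g (suc i))))
  (solve 4 (λ a b c d → (a :- b) :+ (c :- d) := (a :+ c) :- (b :+ d)) refl (f zero) (g zero) _ _)

sumℚ-*ˡ : ∀ {k} (c : ℚ) (f : Fin k → ℚ) → sumℚ (λ i → c * f i) ≡ c * sumℚ f
sumℚ-*ˡ {zero} c f = sym (ℚP.*-zeroʳ c)
sumℚ-*ˡ {suc k} c f =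
  trans (cong (_+_ (c * f zero)) (sumℚ-*ˡ c (λ i → f (suc i)))) (sym (ℚP.*-distribˡ-+ c (f zero) _))

sumℚ-zero : ∀ {k} (f : Fin k → ℚ) → (∀ i → f i ≡ 0ℚ) → sumℚ f ≡ 0ℚ
sumℚ-zero {zero} f f≗0 = refl
sumℚ-zero {suc k} f f≗0 = cong₂ _+_ (f≗0 zero) (sumℚ-zero (λ i → f (suc i)) (λ i → f≗0 (suc i)))

sumℚ-single : ∀ {k} (i : Fin k) (f : Fin k → ℚ) → (∀ j → j ≢ i → f j ≡ 0ℚ) → sumℚ f ≡ f i
sumℚ-single zero f off = trans (cong (_+_ (f zero)) (sumℚ-zero _ (λ j → off (suc j) (λ ())))) (ℚP.+-identityʳ (f zero))
sumℚ-single (suc i) f off = trans (cong (_+ sumℚ (λ j → f (suc j))) (off zero (λ ())))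
  (trans (ℚP.+-identityˡ _) (sumℚ-single i (λ j → f (suc j)) (λ j j≢i → off (suc j) (j≢i ∘ suc-injective))))

prodℚ-cong : ∀ {k} {f g : Fin k → ℚ} → (∀ i → f i ≡ g i) → prodℚ f ≡ prodℚ g
prodℚ-cong {zero} f≗g = refl
prodℚ-cong {suc k} f≗g = cong₂ _*_ (f≗g zero) (prodℚ-cong (λ i → f≗g (suc i)))

ι : ℤ → ℚ
ι x = x / 1

-- With both arguments in this normal form, ℚ's _+_ reduces to ι of an integer expression.
ι≡mkℚ : ∀ x → ι x ≡ mkℚ x 0 (Coprime.sym (Coprime.1-coprimeTo ℤ.∣ x ∣))
ι≡mkℚ (+ n) = ℚP.normalize-coprime (Coprime.sym (Coprime.1-coprimeTo n))
ι≡mkℚ -[1+ n ] = cong -_ (ℚP.normalize-coprime (Coprime.sym (Coprime.1-coprimeTo (suc n))))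

ι-+ : ∀ x y → ι (x ℤ.+ y) ≡ ι x + ι y
ι-+ x y = begin
  ι (x ℤ.+ y)                  ≡⟨ cong ι (cong₂ ℤ._+_ (sym (ℤP.*-identityʳ x)) (sym (ℤP.*-identityʳ y))) ⟩
  ι (x ℤ.* + 1 ℤ.+ y ℤ.* + 1)  ≡⟨ sym (cong₂ _+_ (ι≡mkℚ x) (ι≡mkℚ y)) ⟩
  ι x + ι y                    ∎
  where open ≡-Reasoning

ι-neg : ∀ x → ι (ℤ.- x) ≡ - ι x
ι-neg (+ zero) = refl
ι-neg (+ suc n) = trans (ι≡mkℚ -[1+ n ]) (cong -_ (sym (ι≡mkℚ (+ suc n))))
ι-neg -[1+ n ] = trans (ι≡mkℚ (+ suc n)) (cong -_ (sym (ι≡mkℚ -[1+ n ])))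

ι-sumℕ : ∀ {k} (f : Fin k → ℕ) → ι (+ sumℕ f) ≡ sumℚ (λ i → ι (+ f i))
ι-sumℕ {zero} f = refl
ι-sumℕ {suc k} f = trans (ι-+ (+ f zero) (+ sumℕ (λ i → f (suc i)))) (cong (_+_ (ι (+ f zero))) (ι-sumℕ (λ i → f (suc i))))

sumℚ-const : ∀ k (c : ℚ) → sumℚ {k} (λ _ → c) ≡ ι (+ k) * c
sumℚ-const zero c = sym (ℚP.*-zeroˡ c)
sumℚ-const (suc k) c = begin
  c + sumℚ {k} (λ _ → c)  ≡⟨ cong (_+_ c) (sumℚ-const k c) ⟩
  c + ι (+ k) * c         ≡⟨ solve 2 (λ c x → c :+ x :* c := (con 1ℚ :+ x) :* c) refl c (ι (+ k)) ⟩
  (1ℚ + ι (+ k)) * c      ≡⟨ cong (_* c) (sym (ι-+ (+ 1) (+ k))) ⟩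
  ι (+ suc k) * c         ∎
  where open ≡-Reasoning

IsSign : ℤ → Set
IsSign x = x ≡ + 1 ⊎ x ≡ -1ℤ

IsSign-* : ∀ {x y} → IsSign x → IsSign y → IsSign (x ℤ.* y)
IsSign-* (inj₁ refl) (inj₁ refl) = inj₁ refl
IsSign-* (inj₁ refl) (inj₂ refl) = inj₂ refl
IsSign-* (inj₂ refl) (inj₁ refl) = inj₂ refl
IsSign-* (inj₂ refl) (inj₂ refl) = inj₁ refl

IsSign-^ : ∀ k → IsSign (-1ℤ ℤ.^ k)
IsSign-^ zero = inj₁ refl
IsSign-^ (suc k) = IsSign-* (inj₂ refl) (IsSign-^ k)

IsSign⇒isEdge≡1 : ∀ {x} → IsSign x → isEdge x ≡ 1
IsSign⇒isEdge≡1 (inj₁ refl) = refl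
IsSign⇒isEdge≡1 (inj₂ refl) = refl

IsSign⇒ι²≡1 : ∀ {x} → IsSign x → ι x * ι x ≡ 1ℚ
IsSign⇒ι²≡1 (inj₁ refl) = refl
IsSign⇒ι²≡1 (inj₂ refl) = refl

edgeFactor-isSign : ∀ {x} → SignEntry x → IsSign (edgeFactor x)
edgeFactor-isSign none = inj₁ refl
edgeFactor-isSign pos = inj₁ refl
edgeFactor-isSign neg = inj₂ refl

prodℤ-isSign : ∀ {k} (f : Fin k → ℤ) → (∀ j → IsSign (f j)) → IsSign (prodℤ f)
prodℤ-isSign {zero} f signs = inj₁ refl
prodℤ-isSign {suc k} f signs = IsSign-* (signs zero) (prodℤ-isSign (λ j → f (suc j)) (λ j → signs (suc j)))

prodℤ-edgeFactor : ∀ {k} (f : Fin k → ℤ) → (∀ j → SignEntry (f j)) →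
  prodℤ (λ j → edgeFactor (f j)) ≡ -1ℤ ℤ.^ sumℕ (λ j → isNeg (f j))
prodℤ-edgeFactor {zero} f entries = refl
prodℤ-edgeFactor {suc k} f entries = step (entries zero)
  where
  rest : ℕ
  rest = sumℕ (λ j → isNeg (f (suc j)))
  ih : prodℤ (λ j → edgeFactor (f (suc j))) ≡ -1ℤ ℤ.^ rest
  ih = prodℤ-edgeFactor (λ j → f (suc j)) (λ j → entries (suc j))
  step : SignEntry (f zero) →
    edgeFactor (f zero) ℤ.* prodℤ (λ j → edgeFactor (f (suc j))) ≡ -1ℤ ℤ.^ (isNeg (f zero) ℕ.+ rest)
  step e with f zero | e
  ... | _ | none = trans (ℤP.*-identityˡ _) ih
  ... | _ | pos = trans (ℤP.*-identityˡ _) ih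
  ... | _ | neg = cong (-1ℤ ℤ.*_) ih

marking-isSign : ∀ {n} (G : SignedGraph n) v → IsSign (marking G v)
marking-isSign G v = prodℤ-isSign _ (λ w → edgeFactor-isSign (entry G v w))

marking≡-1^deg⁻ : ∀ {n} (G : SignedGraph n) v → marking G v ≡ -1ℤ ℤ.^ deg⁻ G v
marking≡-1^deg⁻ G v = prodℤ-edgeFactor (A G v) (entry G v)

ι-isEdge : ∀ {x} → SignEntry x → ι (+ isEdge x) ≡ ι (+ isPos x) + ι (+ isNeg x)
ι-isEdge none = refl
ι-isEdge pos = refl
ι-isEdge neg = refl

ι-signEntry : ∀ {x} → SignEntry x → ι x ≡ ι (+ isPos x) - ι (+ isNeg x)
ι-signEntry none = refl
ι-signEntry pos = refl
ι-signEntry neg = refl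

ι-deg : ∀ {n} (G : SignedGraph n) v → ι (+ deg G v) ≡ ι (+ deg⁺ G v) + ι (+ deg⁻ G v)
ι-deg {n} G v = begin
  ι (+ deg G v)                            ≡⟨ ι-sumℕ (λ w → isEdge (A G v w)) ⟩
  sumℚ (λ w → ι (+ isEdge (A G v w)))      ≡⟨ sumℚ-cong (λ w → ι-isEdge (entry G v w)) ⟩
  sumℚ (λ w → ι (+ plus w) + ι (+ minus w)) ≡⟨ sumℚ-+ (λ w → ι (+ plus w)) (λ w → ι (+ minus w)) ⟩
  sumℚ (λ w → ι (+ plus w)) + sumℚ (λ w → ι (+ minus w))
                                           ≡⟨ sym (cong₂ _+_ (ι-sumℕ plus) (ι-sumℕ minus)) ⟩
  ι (+ deg⁺ G v) + ι (+ deg⁻ G v)          ∎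
  where
  open ≡-Reasoning
  plus minus : Fin n → ℕ
  plus w = isPos (A G v w)
  minus w = isNeg (A G v w)

ι-rowSum : ∀ {n} (G : SignedGraph n) v → sumℚ (λ w → ι (A G v w)) ≡ ι (+ deg⁺ G v) - ι (+ deg⁻ G v)
ι-rowSum {n} G v = begin
  sumℚ (λ w → ι (A G v w))                 ≡⟨ sumℚ-cong (λ w → ι-signEntry (entry G v w)) ⟩
  sumℚ (λ w → ι (+ plus w) - ι (+ minus w)) ≡⟨ sumℚ-- (λ w → ι (+ plus w)) (λ w → ι (+ minus w)) ⟩
  sumℚ (λ w → ι (+ plus w)) - sumℚ (λ w → ι (+ minus w))
                                           ≡⟨ sym (cong₂ _-_ (ι-sumℕ plus) (ι-sumℕ minus)) ⟩
  ι (+ deg⁺ G v) - ι (+ deg⁻ G v)          ∎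
  where
  open ≡-Reasoning
  plus minus : Fin n → ℕ
  plus w = isPos (A G v w)
  minus w = isNeg (A G v w)

Mat : ℕ → Set
Mat n = Fin n → Fin n → ℚ

altSum-cong : ∀ {n} {f g : Fin n → ℚ} → (∀ i → f i ≡ g i) → altSum f ≡ altSum g
altSum-cong {zero} f≗g = refl
altSum-cong {suc n} f≗g = cong₂ _-_ (f≗g zero) (altSum-cong (λ i → f≗g (suc i)))

altSum-+ : ∀ {n} (f g : Fin n → ℚ) → altSum (λ i → f i + g i) ≡ altSum f + altSum g
altSum-+ {zero} f g = refl
altSum-+ {suc n} f g =
  trans (cong (_-_ (f zero + g zero)) (altSum-+ (λ i → f (suc i)) (λ i → g (suc i))))
    (solve 4 (λ a b c d → (a :+ b) :- (c :+ d) := (a :- c) :+ (b :- d)) refl (f zero) (g zero) _ _)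

altSum-*ˡ : ∀ {n} (c : ℚ) (f : Fin n → ℚ) → altSum (λ i → c * f i) ≡ c * altSum f
altSum-*ˡ {zero} c f = sym (ℚP.*-zeroʳ c)
altSum-*ˡ {suc n} c f =
  trans (cong (_-_ (c * f zero)) (altSum-*ˡ c (λ i → f (suc i))))
    (solve 3 (λ c a b → c :* a :- c :* b := c :* (a :- b)) refl c (f zero) _)

altSum-*ʳ : ∀ {n} (c : ℚ) (f : Fin n → ℚ) → altSum (λ i → f i * c) ≡ altSum f * c
altSum-*ʳ c f =
  trans (altSum-cong (λ i → ℚP.*-comm (f i) c)) (trans (altSum-*ˡ c f) (ℚP.*-comm c (altSum f)))

altSum-neg : ∀ {n} (f : Fin n → ℚ) → altSum (λ i → - f i) ≡ - altSum f
altSum-neg {zero} f = refl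
altSum-neg {suc n} f =
  trans (cong (_-_ (- f zero)) (altSum-neg (λ i → f (suc i))))
    (solve 2 (λ a b → :- a :- :- b := :- (a :- b)) refl (f zero) _)

altSum-zero : ∀ {n} (f : Fin n → ℚ) → (∀ i → f i ≡ 0ℚ) → altSum f ≡ 0ℚ
altSum-zero {zero} f f≗0 = refl
altSum-zero {suc n} f f≗0 = cong₂ _-_ (f≗0 zero) (altSum-zero (λ i → f (suc i)) (λ i → f≗0 (suc i)))

altSum-↑ˡ : ∀ a {b} (f : Fin (a ℕ.+ b) → ℚ) → (∀ q → f (a ↑ʳ q) ≡ 0ℚ) →
  altSum f ≡ altSum (λ c → f (c ↑ˡ b))
altSum-↑ˡ zero f f≗0 = altSum-zero f f≗0
altSum-↑ˡ (suc a) f f≗0 = cong (_-_ (f zero)) (altSum-↑ˡ a (λ i → f (suc i)) f≗0)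

minor : ∀ {n} → Mat (suc n) → Fin (suc n) → Mat n
minor M j r c = M (suc r) (punchIn j c)

cofactorExpansion : ∀ {n} → (Fin (suc n) → ℚ) → Mat (suc n) → ℚ
cofactorExpansion x M = altSum (λ j → x j * det (minor M j))

det-cong : ∀ {n} {M N : Mat n} → (∀ i j → M i j ≡ N i j) → det M ≡ det N
det-cong {zero} M≗N = refl
det-cong {suc n} M≗N =
  altSum-cong (λ j → cong₂ _*_ (M≗N zero j) (det-cong (λ r c → M≗N (suc r) (punchIn j c))))

cofactorExpansion-cong : ∀ {n} {x y : Fin (suc n) → ℚ} (M : Mat (suc n)) → (∀ c → x c ≡ y c) →
  cofactorExpansion x M ≡ cofactorExpansion y M
cofactorExpansion-cong M x≗y = altSum-cong (λ j → cong (_* det (minor M j)) (x≗y j))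

cofactorExpansion-linear : ∀ {n} (x y : Fin (suc n) → ℚ) (a : ℚ) (M : Mat (suc n)) →
  cofactorExpansion (λ c → x c + a * y c) M ≡ cofactorExpansion x M + a * cofactorExpansion y M
cofactorExpansion-linear {n} x y a M = begin
  altSum (λ j → (x j + a * y j) * D j)
    ≡⟨ altSum-cong (λ j → solve 4 (λ x a y d → (x :+ a :* y) :* d := x :* d :+ a :* (y :* d)) refl (x j) a (y j) (D j)) ⟩
  altSum (λ j → x j * D j + a * (y j * D j))
    ≡⟨ altSum-+ (λ j → x j * D j) (λ j → a * (y j * D j)) ⟩
  altSum (λ j → x j * D j) + altSum (λ j → a * (y j * D j))
    ≡⟨ cong (_+_ (altSum (λ j → x j * D j))) (altSum-*ˡ a (λ j → y j * D j)) ⟩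
  altSum (λ j → x j * D j) + a * altSum (λ j → y j * D j) ∎
  where
  open ≡-Reasoning
  D : Fin (suc n) → ℚ
  D j = det (minor M j)

Extensional : ∀ {a b} → ((Fin a → Fin b) → ℚ) → Set
Extensional F = ∀ g h → (∀ t → g t ≡ h t) → F g ≡ F h

-- Laplace expansion along two rows x and y; F g stands for the determinant of the
-- remaining rows restricted to the columns g.
twoRowExpansion : ∀ {n} → (x y : Fin (suc (suc n)) → ℚ) → ((Fin n → Fin (suc (suc n))) → ℚ) → ℚ
twoRowExpansion x y F = altSum (λ j → x j * altSum (λ k → y (punchIn j k) * F (punchIn j ∘ punchIn k)))

expansionOffColumn₀ : ∀ {n} → (Fin (suc (suc n)) → ℚ) → ((Fin n → Fin (suc (suc n))) → ℚ) → ℚ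
expansionOffColumn₀ y F = altSum (λ k → y (suc k) * F (suc ∘ punchIn k))

twoRowExpansion-suc : ∀ {n} (x y : Fin (suc (suc (suc n))) → ℚ) (F : (Fin (suc n) → Fin (suc (suc (suc n)))) → ℚ) →
  Extensional F →
  twoRowExpansion x y F ≡ x zero * expansionOffColumn₀ y F - y zero * expansionOffColumn₀ x F
                          + twoRowExpansion (x ∘ suc) (y ∘ suc) (F ∘ lift 1)
twoRowExpansion-suc {n} x y F F-ext = begin
  X₀ - altSum (λ j → x (suc j) * (y zero * B j - C′ j))
    ≡⟨ cong (_-_ X₀) (altSum-cong (λ j → cong (λ z → x (suc j) * (y zero * B j - z)) (C′≡C j))) ⟩
  X₀ - altSum (λ j → x (suc j) * (y zero * B j - C j))
    ≡⟨ cong (_-_ X₀) (altSum-cong (λ j →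
         solve 4 (λ a b c d → a :* (b :* c :- d) := b :* (a :* c) :+ :- (a :* d)) refl (x (suc j)) (y zero) (B j) (C j))) ⟩
  X₀ - altSum (λ j → y zero * (x (suc j) * B j) + - (x (suc j) * C j))
    ≡⟨ cong (_-_ X₀) (altSum-+ (λ j → y zero * (x (suc j) * B j)) (λ j → - (x (suc j) * C j))) ⟩
  X₀ - (altSum (λ j → y zero * (x (suc j) * B j)) + altSum (λ j → - (x (suc j) * C j)))
    ≡⟨ cong₂ (λ u v → X₀ - (u + v)) (altSum-*ˡ (y zero) (λ j → x (suc j) * B j)) (altSum-neg (λ j → x (suc j) * C j)) ⟩
  X₀ - (Y₀ + - rest)
    ≡⟨ solve 3 (λ a b d → a :- (b :+ :- d) := a :- b :+ d) refl X₀ Y₀ rest ⟩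
  X₀ - Y₀ + rest ∎
  where
  open ≡-Reasoning
  X₀ Y₀ rest : ℚ
  X₀ = x zero * expansionOffColumn₀ y F
  Y₀ = y zero * expansionOffColumn₀ x F
  rest = twoRowExpansion (x ∘ suc) (y ∘ suc) (F ∘ lift 1)
  B C C′ : Fin (suc (suc n)) → ℚ
  B j = F (suc ∘ punchIn j)
  C j = altSum (λ k → y (suc (punchIn j k)) * F (lift 1 (punchIn j ∘ punchIn k)))
  C′ j = altSum (λ k → y (suc (punchIn j k)) * F (punchIn (suc j) ∘ punchIn (suc k)))
  C′≡C : ∀ j → C′ j ≡ C j
  C′≡C j = altSum-cong (λ k → cong (y (suc (punchIn j k)) *_)
    (F-ext (punchIn (suc j) ∘ punchIn (suc k)) (lift 1 (punchIn j ∘ punchIn k)) (λ { zero → refl ; (suc t) → refl })))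

twoRowExpansion-antisym : ∀ {n} (x y : Fin (suc (suc n)) → ℚ) (F : (Fin n → Fin (suc (suc n))) → ℚ) →
  Extensional F → twoRowExpansion x y F ≡ - twoRowExpansion y x F
twoRowExpansion-antisym {zero} x y F F-ext = begin
  x₀ * (y₁ * F g₀₁ - 0ℚ) - (x₁ * (y₀ * F g₁₀ - 0ℚ) - 0ℚ)
    ≡⟨ cong (λ z → x₀ * (y₁ * F g₀₁ - 0ℚ) - (x₁ * (y₀ * z - 0ℚ) - 0ℚ)) (F-ext g₁₀ g₀₁ (λ ())) ⟩
  x₀ * (y₁ * F g₀₁ - 0ℚ) - (x₁ * (y₀ * F g₀₁ - 0ℚ) - 0ℚ)
    ≡⟨ solve 5 (λ a b c d f → a :* (b :* f :- con 0ℚ) :- (c :* (d :* f :- con 0ℚ) :- con 0ℚ)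
                := :- (d :* (c :* f :- con 0ℚ) :- (b :* (a :* f :- con 0ℚ) :- con 0ℚ)))
         refl x₀ y₁ x₁ y₀ (F g₀₁) ⟩
  - (y₀ * (x₁ * F g₀₁ - 0ℚ) - (y₁ * (x₀ * F g₀₁ - 0ℚ) - 0ℚ))
    ≡⟨ cong (λ z → - (y₀ * (x₁ * F g₀₁ - 0ℚ) - (y₁ * (x₀ * z - 0ℚ) - 0ℚ))) (F-ext g₀₁ g₁₀ (λ ())) ⟩
  - (y₀ * (x₁ * F g₀₁ - 0ℚ) - (y₁ * (x₀ * F g₁₀ - 0ℚ) - 0ℚ)) ∎
  where
  open ≡-Reasoning
  x₀ x₁ y₀ y₁ : ℚ
  x₀ = x zero
  x₁ = x (suc zero)
  y₀ = y zero
  y₁ = y (suc zero)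
  g₀₁ g₁₀ : Fin 0 → Fin 2
  g₀₁ = punchIn zero ∘ punchIn zero
  g₁₀ = punchIn (suc zero) ∘ punchIn zero
twoRowExpansion-antisym {suc n} x y F F-ext = begin
  twoRowExpansion x y F
    ≡⟨ twoRowExpansion-suc x y F F-ext ⟩
  X₀ - Y₀ + twoRowExpansion (x ∘ suc) (y ∘ suc) (F ∘ lift 1)
    ≡⟨ cong (_+_ (X₀ - Y₀)) (twoRowExpansion-antisym (x ∘ suc) (y ∘ suc) (F ∘ lift 1) lift-ext) ⟩
  X₀ - Y₀ + - twoRowExpansion (y ∘ suc) (x ∘ suc) (F ∘ lift 1)
    ≡⟨ solve 3 (λ a b c → a :- b :+ :- c := :- (b :- a :+ c)) refl X₀ Y₀ (twoRowExpansion (y ∘ suc) (x ∘ suc) (F ∘ lift 1)) ⟩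
  - (Y₀ - X₀ + twoRowExpansion (y ∘ suc) (x ∘ suc) (F ∘ lift 1))
    ≡⟨ cong -_ (twoRowExpansion-suc y x F F-ext) ⟨
  - twoRowExpansion y x F ∎
  where
  open ≡-Reasoning
  X₀ Y₀ : ℚ
  X₀ = x zero * expansionOffColumn₀ y F
  Y₀ = y zero * expansionOffColumn₀ x F
  lift-ext : Extensional (F ∘ lift 1)
  lift-ext g h g≗h = F-ext (lift 1 g) (lift 1 h) (λ { zero → refl ; (suc t) → cong suc (g≗h t) })

swap₀₁ : ∀ {n} → Fin (suc (suc n)) → Fin (suc (suc n))
swap₀₁ zero = suc zero
swap₀₁ (suc zero) = zero
swap₀₁ (suc (suc i)) = suc (suc i)

det-swap₀₁ : ∀ {n} (M : Mat (suc (suc n))) → det (M ∘ swap₀₁) ≡ - det M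
det-swap₀₁ M = twoRowExpansion-antisym (M (suc zero)) (M zero) (λ g → det (λ i t → M (suc (suc i)) (g t)))
  (λ g h g≗h → det-cong (λ i t → cong (M (suc (suc i))) (g≗h t)))

x≡-x⇒x≡0 : ∀ x → x ≡ - x → x ≡ 0ℚ
x≡-x⇒x≡0 x x≡-x = begin
  x             ≡⟨ solve 1 (λ x → x := con ½ :* (x :+ x)) refl x ⟩
  ½ * (x + x)   ≡⟨ cong (λ z → ½ * (x + z)) x≡-x ⟩
  ½ * (x + - x) ≡⟨ solve 1 (λ x → con ½ :* (x :+ :- x) := con 0ℚ) refl x ⟩
  0ℚ            ∎
  where open ≡-Reasoning

-- Swapping rows 0 and 1 turns a repetition of row 0 further down into a repetition
-- between two rows of every minor.
det-firstRowRepeated : ∀ {n} (M : Mat (suc n)) (k : Fin n) → (∀ c → M zero c ≡ M (suc k) c) → det M ≡ 0ℚ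
det-firstRowRepeated M zero M₀≗M₁ = x≡-x⇒x≡0 (det M) (trans (sym (det-cong swapped≗M)) (det-swap₀₁ M))
  where
  swapped≗M : ∀ i c → M (swap₀₁ i) c ≡ M i c
  swapped≗M zero c = sym (M₀≗M₁ c)
  swapped≗M (suc zero) c = M₀≗M₁ c
  swapped≗M (suc (suc i)) c = refl
det-firstRowRepeated M (suc k) M₀≗M₂₊ₖ = begin
  det M              ≡⟨ solve 1 (λ d → d := :- (:- d)) refl (det M) ⟩
  - - det M          ≡⟨ cong -_ (sym (det-swap₀₁ M)) ⟩
  - det (M ∘ swap₀₁) ≡⟨ cong -_ (altSum-zero _ (λ j → trans (cong (M (suc zero) j *_) (minor≡0 j))
                                                              (ℚP.*-zeroʳ (M (suc zero) j)))) ⟩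
  - 0ℚ               ≡⟨⟩
  0ℚ                 ∎
  where
  open ≡-Reasoning
  minor≡0 : ∀ j → det (minor (M ∘ swap₀₁) j) ≡ 0ℚ
  minor≡0 j = det-firstRowRepeated (minor (M ∘ swap₀₁) j) k (λ c → M₀≗M₂₊ₖ (punchIn j c))

withFirstRow : ∀ {n} → (Fin (suc n) → ℚ) → Mat (suc n) → Mat (suc n)
withFirstRow x M zero = x
withFirstRow x M (suc r) = M (suc r)

cofactorExpansion-laterRow : ∀ {n} (M : Mat (suc n)) (k : Fin n) → cofactorExpansion (M (suc k)) M ≡ 0ℚ
cofactorExpansion-laterRow M k = det-firstRowRepeated (withFirstRow (M (suc k)) M) k (λ c → refl)

cofactorExpansion-addLaterRows : ∀ {n t} (x : Fin (suc n) → ℚ) (M : Mat (suc n)) (g : Fin t → Fin n) (e : Fin t → ℚ) →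
  cofactorExpansion (λ c → x c + sumℚ (λ w → e w * M (suc (g w)) c)) M ≡ cofactorExpansion x M
cofactorExpansion-addLaterRows {t = zero} x M g e = cofactorExpansion-cong M (λ c → ℚP.+-identityʳ (x c))
cofactorExpansion-addLaterRows {n} {suc t} x M g e = begin
  cofactorExpansion (λ c → x c + (e zero * R c + later c)) M
    ≡⟨ cofactorExpansion-cong M (λ c → ℚP.+-assoc (x c) (e zero * R c) (later c)) ⟨
  cofactorExpansion (λ c → (x c + e zero * R c) + later c) M
    ≡⟨ cofactorExpansion-addLaterRows (λ c → x c + e zero * R c) M (g ∘ suc) (e ∘ suc) ⟩
  cofactorExpansion (λ c → x c + e zero * R c) M
    ≡⟨ cofactorExpansion-linear x R (e zero) M ⟩
  cofactorExpansion x M + e zero * cofactorExpansion R M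
    ≡⟨ cong (λ z → cofactorExpansion x M + e zero * z) (cofactorExpansion-laterRow M (g zero)) ⟩
  cofactorExpansion x M + e zero * 0ℚ
    ≡⟨ solve 2 (λ d a → d :+ a :* con 0ℚ := d) refl (cofactorExpansion x M) (e zero) ⟩
  cofactorExpansion x M ∎
  where
  open ≡-Reasoning
  R later : Fin (suc n) → ℚ
  R = M (suc (g zero))
  later c = sumℚ (λ w → e (suc w) * M (suc (g (suc w))) c)

det-addToTopRows : ∀ n {p t} (M N : Mat (n ℕ.+ p)) (g : Fin n → Fin t → Fin p) (e : Fin n → Fin t → ℚ) →
  (∀ i c → N (i ↑ˡ p) c ≡ M (i ↑ˡ p) c + sumℚ (λ w → e i w * M (n ↑ʳ g i w) c)) →
  (∀ q c → N (n ↑ʳ q) c ≡ M (n ↑ʳ q) c) → det N ≡ det M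
det-addToTopRows zero M N g e top bottom = det-cong bottom
det-addToTopRows (suc n) M N g e top bottom = begin
  altSum (λ j → N zero j * det (minor N j))
    ≡⟨ altSum-cong (λ j → cong (N zero j *_) (det-addToTopRows n (minor M j) (minor N j) (g ∘ suc) (e ∘ suc)
         (λ i c → top (suc i) (punchIn j c)) (λ q c → bottom q (punchIn j c)))) ⟩
  cofactorExpansion (N zero) M
    ≡⟨ cofactorExpansion-cong M (top zero) ⟩
  cofactorExpansion (λ c → M zero c + sumℚ (λ w → e zero w * M (suc (n ↑ʳ g zero w)) c)) M
    ≡⟨ cofactorExpansion-addLaterRows (M zero) M (λ w → n ↑ʳ g zero w) (e zero) ⟩
  det M ∎
  where open ≡-Reasoning

punchIn-↑ˡ : ∀ {n} p (c : Fin (suc n)) (j : Fin n) → punchIn (c ↑ˡ p) (j ↑ˡ p) ≡ punchIn c j ↑ˡ p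
punchIn-↑ˡ p zero j = refl
punchIn-↑ˡ p (suc c) zero = refl
punchIn-↑ˡ p (suc c) (suc j) = cong suc (punchIn-↑ˡ p c j)

punchIn-↑ʳ : ∀ n {p} (c : Fin (suc n)) (q : Fin p) → punchIn (c ↑ˡ p) (n ↑ʳ q) ≡ suc n ↑ʳ q
punchIn-↑ʳ n zero q = refl
punchIn-↑ʳ (suc n) (suc c) q = cong suc (punchIn-↑ʳ n c q)

det-blockTriangular : ∀ n {p} (M : Mat (n ℕ.+ p)) → (∀ i q → M (i ↑ˡ p) (n ↑ʳ q) ≡ 0ℚ) →
  det M ≡ det (λ i j → M (i ↑ˡ p) (j ↑ˡ p)) * det (λ q q′ → M (n ↑ʳ q) (n ↑ʳ q′))
det-blockTriangular zero M upperRight≡0 = sym (ℚP.*-identityˡ (det M))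
det-blockTriangular (suc n) {p} M upperRight≡0 = begin
  altSum (λ j → M zero j * det (minor M j))
    ≡⟨ altSum-↑ˡ (suc n) (λ j → M zero j * det (minor M j))
         (λ q → trans (cong (_* det (minor M (suc n ↑ʳ q))) (upperRight≡0 zero q))
                      (ℚP.*-zeroˡ (det (minor M (suc n ↑ʳ q))))) ⟩
  altSum (λ c → M zero (c ↑ˡ p) * det (minor M (c ↑ˡ p)))
    ≡⟨ altSum-cong (λ c → cong (M zero (c ↑ˡ p) *_) (minor-factors c)) ⟩
  altSum (λ c → X zero c * (det (minor X c) * det Z))
    ≡⟨ altSum-cong (λ c → sym (ℚP.*-assoc (X zero c) (det (minor X c)) (det Z))) ⟩
  altSum (λ c → X zero c * det (minor X c) * det Z)
    ≡⟨ altSum-*ʳ (det Z) (λ c → X zero c * det (minor X c)) ⟩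
  det X * det Z ∎
  where
  open ≡-Reasoning
  X : Mat (suc n)
  X i j = M (i ↑ˡ p) (j ↑ˡ p)
  Z : Mat p
  Z q q′ = M (suc n ↑ʳ q) (suc n ↑ʳ q′)
  minor-factors : ∀ c → det (minor M (c ↑ˡ p)) ≡ det (minor X c) * det Z
  minor-factors c = begin
    det (minor M (c ↑ˡ p))
      ≡⟨ det-blockTriangular n (minor M (c ↑ˡ p))
           (λ i q → trans (cong (M (suc (i ↑ˡ p))) (punchIn-↑ʳ n c q)) (upperRight≡0 (suc i) q)) ⟩
    det (λ i j → M (suc (i ↑ˡ p)) (punchIn (c ↑ˡ p) (j ↑ˡ p)))
      * det (λ q q′ → M (suc (n ↑ʳ q)) (punchIn (c ↑ˡ p) (n ↑ʳ q′)))
      ≡⟨ cong₂ _*_ (det-cong (λ i j → cong (M (suc (i ↑ˡ p))) (punchIn-↑ˡ p c j)))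
                   (det-cong (λ q q′ → cong (M (suc (n ↑ʳ q))) (punchIn-↑ʳ n c q′))) ⟩
    det (minor X c) * det Z ∎

det-blockDiagonal : ∀ n {m} (Z : Mat (n ℕ.* m)) →
  (∀ l l′ (w w′ : Fin m) → l ≢ l′ → Z (combine {n} {m} l w) (combine l′ w′) ≡ 0ℚ) →
  det Z ≡ prodℚ (λ l → det (λ w w′ → Z (combine {n} {m} l w) (combine l w′)))
det-blockDiagonal zero Z offBlocks≡0 = refl
det-blockDiagonal (suc n) {m} Z offBlocks≡0 = begin
  det Z
    ≡⟨ det-blockTriangular m Z (λ w q → trans (cong (λ z → Z (w ↑ˡ (n ℕ.* m)) (m ↑ʳ z)) (sym (combine-remQuot {n} m q)))
                                         (offBlocks≡0 zero (suc (proj₁ (remQuot {n} m q))) w (proj₂ (remQuot {n} m q)) (λ ()))) ⟩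
  det (λ w w′ → Z (w ↑ˡ (n ℕ.* m)) (w′ ↑ˡ (n ℕ.* m))) * det Z′
    ≡⟨ cong (det (λ w w′ → Z (w ↑ˡ (n ℕ.* m)) (w′ ↑ˡ (n ℕ.* m))) *_)
         (det-blockDiagonal n Z′ (λ l l′ w w′ l≢l′ → offBlocks≡0 (suc l) (suc l′) w w′ (l≢l′ ∘ suc-injective))) ⟩
  prodℚ (λ l → det (λ w w′ → Z (combine {suc n} {m} l w) (combine l w′))) ∎
  where
  open ≡-Reasoning
  Z′ : Mat (n ℕ.* m)
  Z′ q q′ = Z (m ↑ʳ q) (m ↑ʳ q′)

-- charLM keeps the matrix αI − L in a where-clause; this pair exposes it under a name.
charMatrixOf : ∀ {n} (A : Fin n → Fin n → ℤ) (α : ℚ) → Σ (Mat n) (λ X → charLM A α ≡ det X)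
charMatrixOf A α = _ , refl

charMatrix : ∀ {n} → (Fin n → Fin n → ℤ) → ℚ → Mat n
charMatrix A α = proj₁ (charMatrixOf A α)

charLM≡det : ∀ {n} (A : Fin n → Fin n → ℤ) α → charLM A α ≡ det (charMatrix A α)
charLM≡det A α = proj₂ (charMatrixOf A α)

laplacianM-diag : ∀ {n} (A : Fin n → Fin n → ℤ) i → laplacianM A i i ≡ + degM A i ℤ.- A i i
laplacianM-diag A i with i ≟ i
... | yes _ = refl
... | no i≢i = ⊥-elim (i≢i refl)

laplacianM-offDiag : ∀ {n} (A : Fin n → Fin n → ℤ) i j → i ≢ j → laplacianM A i j ≡ ℤ.- A i j
laplacianM-offDiag A i j i≢j with i ≟ j
... | yes i≡j = ⊥-elim (i≢j i≡j)
... | no _ = refl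

charMatrix-diag : ∀ {n} (A : Fin n → Fin n → ℤ) α i → A i i ≡ + 0 → charMatrix A α i i ≡ α - ι (+ degM A i)
charMatrix-diag A α i Aᵢᵢ≡0 with i ≟ i
... | yes _ = cong (λ z → α - ι z)
  (trans (laplacianM-diag A i) (trans (cong (λ z → + degM A i ℤ.- z) Aᵢᵢ≡0) (ℤP.+-identityʳ (+ degM A i))))
... | no i≢i = ⊥-elim (i≢i refl)

charMatrix-offDiag : ∀ {n} (A : Fin n → Fin n → ℤ) α i j → i ≢ j → charMatrix A α i j ≡ ι (A i j)
charMatrix-offDiag A α i j i≢j with i ≟ j
... | yes i≡j = ⊥-elim (i≢j i≡j)
... | no _ = begin
  - ι (laplacianM A i j)  ≡⟨ cong (-_ ∘ ι) (laplacianM-offDiag A i j i≢j) ⟩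
  - ι (ℤ.- A i j)         ≡⟨ cong -_ (ι-neg (A i j)) ⟩
  - - ι (A i j)           ≡⟨ solve 1 (λ x → :- (:- x) := x) refl (ι (A i j)) ⟩
  ι (A i j)               ∎
  where open ≡-Reasoning

-- Column w of γI − L(H) carries γ − (d⁺ + d⁻) on the diagonal and the signs of the
-- edges at w elsewhere, which add up to d⁺ − d⁻.
charMatrix-columnSum : ∀ {m} (H : SignedGraph m) γ w →
  sumℚ (λ v → charMatrix (A H) γ v w) ≡ γ - ι (+ 2) * ι (+ deg⁻ H w)
charMatrix-columnSum {m} H γ w = begin
  sumℚ column
    ≡⟨ sumℚ-cong (λ v → solve 2 (λ x y → x := (x :- y) :+ y) refl (column v) (edge v)) ⟩
  sumℚ (λ v → diagonal v + edge v)
    ≡⟨ sumℚ-+ diagonal edge ⟩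
  sumℚ diagonal + sumℚ edge
    ≡⟨ cong₂ _+_ (sumℚ-single w diagonal offDiagonal≡0) (ι-rowSum H w) ⟩
  diagonal w + (ι (+ P) - ι (+ N))
    ≡⟨ cong (_+ (ι (+ P) - ι (+ N))) diagonal-w ⟩
  γ - (ι (+ P) + ι (+ N)) - 0ℚ + (ι (+ P) - ι (+ N))
    ≡⟨ solve 3 (λ γ p q → γ :- (p :+ q) :- con 0ℚ :+ (p :- q) := γ :- con (ι (+ 2)) :* q) refl γ (ι (+ P)) (ι (+ N)) ⟩
  γ - ι (+ 2) * ι (+ N) ∎
  where
  open ≡-Reasoning
  P N : ℕ
  P = deg⁺ H w
  N = deg⁻ H w
  column edge diagonal : Fin m → ℚ
  column v = charMatrix (A H) γ v w
  edge v = ι (A H w v)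
  diagonal v = column v - edge v
  offDiagonal≡0 : ∀ v → v ≢ w → diagonal v ≡ 0ℚ
  offDiagonal≡0 v v≢w = trans (cong (_- edge v) (trans (charMatrix-offDiag (A H) γ v w v≢w) (cong ι (symm H v w))))
                              (ℚP.+-inverseʳ (edge v))
  diagonal-w : diagonal w ≡ γ - (ι (+ P) + ι (+ N)) - 0ℚ
  diagonal-w = cong₂ _-_ (trans (charMatrix-diag (A H) γ w (noLoops H w)) (cong (_-_ γ) (ι-deg H w)))
                         (cong ι (noLoops H w))

module CoronaBlocks {n m : ℕ} (G : SignedGraph n) (H : Fin n → SignedGraph m) where

  C : Fin (n ℕ.+ n ℕ.* m) → Fin (n ℕ.+ n ℕ.* m) → ℤ
  C = coronaA G H

  top : Fin n → Fin (n ℕ.+ n ℕ.* m)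
  top i = i ↑ˡ (n ℕ.* m)

  bot : Fin n → Fin m → Fin (n ℕ.+ n ℕ.* m)
  bot l w = n ↑ʳ combine l w

  link : Fin n → Fin m → ℤ
  link l w = marking G l ℤ.* marking (H l) w

  -- coronaA unfolds remQuot to the swapped quotRem before matching on the pair.
  quotRem-combine : ∀ l w → quotRem {n} m (combine l w) ≡ (w , l)
  quotRem-combine l w = cong swap (remQuot-combine {n} {m} l w)

  C-top-top : ∀ i j → C (top i) (top j) ≡ A G i j
  C-top-top i j rewrite splitAt-↑ˡ n i (n ℕ.* m) | splitAt-↑ˡ n j (n ℕ.* m) = refl

  C-top-bot : ∀ l w → C (top l) (bot l w) ≡ link l w
  C-top-bot l w rewrite splitAt-↑ˡ n l (n ℕ.* m) | splitAt-↑ʳ n (n ℕ.* m) (combine l w) | quotRem-combine l w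
    with l ≟ l
  ... | yes _ = refl
  ... | no l≢l = ⊥-elim (l≢l refl)

  C-top-bot-≢ : ∀ i l w → i ≢ l → C (top i) (bot l w) ≡ + 0
  C-top-bot-≢ i l w i≢l rewrite splitAt-↑ˡ n i (n ℕ.* m) | splitAt-↑ʳ n (n ℕ.* m) (combine l w) | quotRem-combine l w
    with i ≟ l
  ... | yes i≡l = ⊥-elim (i≢l i≡l)
  ... | no _ = refl

  C-bot-top : ∀ l w → C (bot l w) (top l) ≡ link l w
  C-bot-top l w rewrite splitAt-↑ˡ n l (n ℕ.* m) | splitAt-↑ʳ n (n ℕ.* m) (combine l w) | quotRem-combine l w
    with l ≟ l
  ... | yes _ = refl
  ... | no l≢l = ⊥-elim (l≢l refl)

  C-bot-top-≢ : ∀ i l w → i ≢ l → C (bot l w) (top i) ≡ + 0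
  C-bot-top-≢ i l w i≢l rewrite splitAt-↑ˡ n i (n ℕ.* m) | splitAt-↑ʳ n (n ℕ.* m) (combine l w) | quotRem-combine l w
    with i ≟ l
  ... | yes i≡l = ⊥-elim (i≢l i≡l)
  ... | no _ = refl

  C-bot-bot : ∀ l w w′ → C (bot l w) (bot l w′) ≡ A (H l) w w′
  C-bot-bot l w w′ rewrite splitAt-↑ʳ n (n ℕ.* m) (combine l w) | splitAt-↑ʳ n (n ℕ.* m) (combine l w′)
                         | quotRem-combine l w | quotRem-combine l w′
    with l ≟ l
  ... | yes _ = refl
  ... | no l≢l = ⊥-elim (l≢l refl)

  C-bot-bot-≢ : ∀ l l′ w w′ → l ≢ l′ → C (bot l w) (bot l′ w′) ≡ + 0
  C-bot-bot-≢ l l′ w w′ l≢l′ rewrite splitAt-↑ʳ n (n ℕ.* m) (combine l w) | splitAt-↑ʳ n (n ℕ.* m) (combine l′ w′)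
                               | quotRem-combine l w | quotRem-combine l′ w′
    with l ≟ l′
  ... | yes l≡l′ = ⊥-elim (l≢l′ l≡l′)
  ... | no _ = refl

  top≢bot : ∀ i l w → top i ≢ bot l w
  top≢bot i l w eq
    with trans (sym (splitAt-↑ˡ n i (n ℕ.* m))) (trans (cong (splitAt n) eq) (splitAt-↑ʳ n (n ℕ.* m) (combine l w)))
  ... | ()

  bot-injective : ∀ l w l′ w′ → bot l w ≡ bot l′ w′ → l ≡ l′ × w ≡ w′
  bot-injective l w l′ w′ eq = combine-injective l w l′ w′ (↑ʳ-injective n (combine l w) (combine l′ w′) eq)

  link-isSign : ∀ l w → IsSign (link l w)
  link-isSign l w = IsSign-* (marking-isSign G l) (marking-isSign (H l) w)

  degM-top : ∀ i → degM C (top i) ≡ deg G i ℕ.+ m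
  degM-top i = begin
    degM C (top i)
      ≡⟨ sumℕ-↑ n (λ y → isEdge (C (top i) y)) ⟩
    sumℕ (λ j → isEdge (C (top i) (top j))) ℕ.+ sumℕ (λ q → isEdge (C (top i) (n ↑ʳ q)))
      ≡⟨ cong₂ ℕ._+_ (sumℕ-cong (λ j → cong isEdge (C-top-top i j)))
                     (sumℕ-combine n (λ q → isEdge (C (top i) (n ↑ʳ q)))) ⟩
    deg G i ℕ.+ sumℕ (λ l → sumℕ (λ w → isEdge (C (top i) (bot l w))))
      ≡⟨ cong (deg G i ℕ.+_)
           (sumℕ-single i _ (λ l l≢i → sumℕ-zero _ (λ w → cong isEdge (C-top-bot-≢ i l w (l≢i ∘ sym))))) ⟩
    deg G i ℕ.+ sumℕ (λ w → isEdge (C (top i) (bot i w)))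
      ≡⟨ cong (deg G i ℕ.+_)
           (sumℕ-ones m _ (λ w → trans (cong isEdge (C-top-bot i w)) (IsSign⇒isEdge≡1 (link-isSign i w)))) ⟩
    deg G i ℕ.+ m ∎
    where open ≡-Reasoning

  degM-bot : ∀ l w → degM C (bot l w) ≡ suc (deg (H l) w)
  degM-bot l w = begin
    degM C (bot l w)
      ≡⟨ sumℕ-↑ n (λ y → isEdge (C (bot l w) y)) ⟩
    sumℕ (λ j → isEdge (C (bot l w) (top j))) ℕ.+ sumℕ (λ q → isEdge (C (bot l w) (n ↑ʳ q)))
      ≡⟨ cong₂ ℕ._+_ (sumℕ-single l _ (λ j j≢l → cong isEdge (C-bot-top-≢ j l w j≢l)))
                     (sumℕ-combine n (λ q → isEdge (C (bot l w) (n ↑ʳ q)))) ⟩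
    isEdge (C (bot l w) (top l)) ℕ.+ sumℕ (λ l′ → sumℕ (λ w′ → isEdge (C (bot l w) (bot l′ w′))))
      ≡⟨ cong₂ ℕ._+_ (trans (cong isEdge (C-bot-top l w)) (IsSign⇒isEdge≡1 (link-isSign l w)))
                     (sumℕ-single l _ (λ l′ l′≢l →
                        sumℕ-zero _ (λ w′ → cong isEdge (C-bot-bot-≢ l l′ w w′ (l′≢l ∘ sym))))) ⟩
    1 ℕ.+ sumℕ (λ w′ → isEdge (C (bot l w) (bot l w′)))
      ≡⟨ cong (1 ℕ.+_) (sumℕ-cong (λ w′ → cong isEdge (C-bot-bot l w w′))) ⟩
    suc (deg (H l) w) ∎
    where open ≡-Reasoning

module CoronaDeterminant {n m : ℕ} (G : SignedGraph n) (H : Fin n → SignedGraph m)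
  (d : ℕ) (deg⁻≡d : ∀ l w → deg⁻ (H l) w ≡ d)
  (α : ℚ) (β≢0 : α - 1ℚ - ι (+ 2) * ι (+ d) ≢ 0ℚ) where

  open CoronaBlocks G H public

  β : ℚ
  β = α - 1ℚ - ι (+ 2) * ι (+ d)

  β⁻¹ : ℚ
  β⁻¹ = 1/_ β {{≢-nonZero β≢0}}

  α′ : ℚ
  α′ = α - ι (+ m) - _÷_ (ι (+ m)) β {{≢-nonZero β≢0}}

  M : Mat (n ℕ.+ n ℕ.* m)
  M = charMatrix C α

  c : Fin n → ℚ
  c l = ι (marking G l ℤ.* -1ℤ ℤ.^ d)

  ι-link : ∀ l w → ι (link l w) ≡ c l
  ι-link l w = cong (λ z → ι (marking G l ℤ.* z)) (trans (marking≡-1^deg⁻ (H l) w) (cong (-1ℤ ℤ.^_) (deg⁻≡d l w)))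

  c²≡1 : ∀ l → c l * c l ≡ 1ℚ
  c²≡1 l = IsSign⇒ι²≡1 (IsSign-* (marking-isSign G l) (IsSign-^ d))

  M-top-top : ∀ i → M (top i) (top i) ≡ α - ι (+ deg G i) - ι (+ m)
  M-top-top i = begin
    M (top i) (top i)             ≡⟨ charMatrix-diag C α (top i) (trans (C-top-top i i) (noLoops G i)) ⟩
    α - ι (+ degM C (top i))      ≡⟨ cong (λ k → α - ι (+ k)) (degM-top i) ⟩
    α - ι (+ (deg G i ℕ.+ m))     ≡⟨ cong (_-_ α) (ι-+ (+ deg G i) (+ m)) ⟩
    α - (ι (+ deg G i) + ι (+ m)) ≡⟨ solve 3 (λ a x y → a :- (x :+ y) := a :- x :- y) refl α (ι (+ deg G i)) (ι (+ m)) ⟩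
    α - ι (+ deg G i) - ι (+ m)   ∎
    where open ≡-Reasoning

  M-top-top-≢ : ∀ i j → i ≢ j → M (top i) (top j) ≡ ι (A G i j)
  M-top-top-≢ i j i≢j =
    trans (charMatrix-offDiag C α (top i) (top j) (i≢j ∘ ↑ˡ-injective (n ℕ.* m) i j)) (cong ι (C-top-top i j))

  M-top-bot : ∀ l w → M (top l) (bot l w) ≡ c l
  M-top-bot l w =
    trans (charMatrix-offDiag C α (top l) (bot l w) (top≢bot l l w)) (trans (cong ι (C-top-bot l w)) (ι-link l w))

  M-top-bot-≢ : ∀ i l w → i ≢ l → M (top i) (bot l w) ≡ 0ℚ
  M-top-bot-≢ i l w i≢l =
    trans (charMatrix-offDiag C α (top i) (bot l w) (top≢bot i l w)) (cong ι (C-top-bot-≢ i l w i≢l))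

  M-bot-top : ∀ l w → M (bot l w) (top l) ≡ c l
  M-bot-top l w =
    trans (charMatrix-offDiag C α (bot l w) (top l) (top≢bot l l w ∘ sym)) (trans (cong ι (C-bot-top l w)) (ι-link l w))

  M-bot-top-≢ : ∀ i l w → i ≢ l → M (bot l w) (top i) ≡ 0ℚ
  M-bot-top-≢ i l w i≢l =
    trans (charMatrix-offDiag C α (bot l w) (top i) (top≢bot i l w ∘ sym)) (cong ι (C-bot-top-≢ i l w i≢l))

  M-bot-bot-≢ : ∀ l l′ w w′ → l ≢ l′ → M (bot l w) (bot l′ w′) ≡ 0ℚ
  M-bot-bot-≢ l l′ w w′ l≢l′ =
    trans (charMatrix-offDiag C α (bot l w) (bot l′ w′) (l≢l′ ∘ proj₁ ∘ bot-injective l w l′ w′))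
          (cong ι (C-bot-bot-≢ l l′ w w′ l≢l′))

  M-bot-bot-diag : ∀ l w → M (bot l w) (bot l w) ≡ charMatrix (A (H l)) (α - 1ℚ) w w
  M-bot-bot-diag l w = begin
    M (bot l w) (bot l w)                   ≡⟨ charMatrix-diag C α (bot l w) (trans (C-bot-bot l w w) (noLoops (H l) w)) ⟩
    α - ι (+ degM C (bot l w))              ≡⟨ cong (λ k → α - ι (+ k)) (degM-bot l w) ⟩
    α - ι (+ suc (deg (H l) w))             ≡⟨ cong (_-_ α) (ι-+ (+ 1) (+ deg (H l) w)) ⟩
    α - (1ℚ + ι (+ deg (H l) w))            ≡⟨ solve 2 (λ a x → a :- (con 1ℚ :+ x) := a :- con 1ℚ :- x) refl α (ι (+ deg (H l) w)) ⟩
    α - 1ℚ - ι (+ deg (H l) w)              ≡⟨ charMatrix-diag (A (H l)) (α - 1ℚ) w (noLoops (H l) w) ⟨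
    charMatrix (A (H l)) (α - 1ℚ) w w       ∎
    where open ≡-Reasoning

  M-bot-bot : ∀ l w w′ → M (bot l w) (bot l w′) ≡ charMatrix (A (H l)) (α - 1ℚ) w w′
  M-bot-bot l w w′ = byCase (w ≟ w′)
    where
    byCase : Dec (w ≡ w′) → M (bot l w) (bot l w′) ≡ charMatrix (A (H l)) (α - 1ℚ) w w′
    byCase (yes refl) = M-bot-bot-diag l w
    byCase (no w≢w′) = begin
      M (bot l w) (bot l w′)                  ≡⟨ charMatrix-offDiag C α (bot l w) (bot l w′) (w≢w′ ∘ proj₂ ∘ bot-injective l w l w′) ⟩
      ι (C (bot l w) (bot l w′))              ≡⟨ cong ι (C-bot-bot l w w′) ⟩
      ι (A (H l) w w′)                        ≡⟨ charMatrix-offDiag (A (H l)) (α - 1ℚ) w w′ w≢w′ ⟨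
      charMatrix (A (H l)) (α - 1ℚ) w w′      ∎
      where open ≡-Reasoning

  block-columnSum : ∀ l w → sumℚ (λ w′ → M (bot l w′) (bot l w)) ≡ β
  block-columnSum l w = begin
    sumℚ (λ w′ → M (bot l w′) (bot l w))                       ≡⟨ sumℚ-cong (λ w′ → M-bot-bot l w′ w) ⟩
    sumℚ (λ w′ → charMatrix (A (H l)) (α - 1ℚ) w′ w)           ≡⟨ charMatrix-columnSum (H l) (α - 1ℚ) w ⟩
    α - 1ℚ - ι (+ 2) * ι (+ deg⁻ (H l) w)                      ≡⟨ cong (λ k → α - 1ℚ - ι (+ 2) * ι (+ k)) (deg⁻≡d l w) ⟩
    β                                                           ∎
    where open ≡-Reasoning

  e : Fin n → ℚ
  e i = - (c i * β⁻¹)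

  e*c≡-β⁻¹ : ∀ i → e i * c i ≡ - β⁻¹
  e*c≡-β⁻¹ i = begin
    - (c i * β⁻¹) * c i    ≡⟨ solve 2 (λ x y → :- (x :* y) :* x := :- (y :* (x :* x))) refl (c i) β⁻¹ ⟩
    - (β⁻¹ * (c i * c i))  ≡⟨ cong (λ z → - (β⁻¹ * z)) (c²≡1 i) ⟩
    - (β⁻¹ * 1ℚ)           ≡⟨ cong -_ (ℚP.*-identityʳ β⁻¹) ⟩
    - β⁻¹                  ∎
    where open ≡-Reasoning

  N : Mat (n ℕ.+ n ℕ.* m)
  N r col with splitAt n r
  ... | inj₁ i = M r col + sumℚ (λ w → e i * M (bot i w) col)
  ... | inj₂ _ = M r col

  N-top : ∀ i col → N (top i) col ≡ M (top i) col + sumℚ (λ w → e i * M (bot i w) col)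
  N-top i col rewrite splitAt-↑ˡ n i (n ℕ.* m) = refl

  N-bot : ∀ q col → N (n ↑ʳ q) col ≡ M (n ↑ʳ q) col
  N-bot q col rewrite splitAt-↑ʳ n (n ℕ.* m) q = refl

  N-upperRight-block : ∀ i l w → N (top i) (bot l w) ≡ 0ℚ
  N-upperRight-block i l w = byCase (i ≟ l)
    where
    open ≡-Reasoning
    byCase : Dec (i ≡ l) → N (top i) (bot l w) ≡ 0ℚ
    byCase (yes refl) = begin
      N (top i) (bot i w)
        ≡⟨ N-top i (bot i w) ⟩
      M (top i) (bot i w) + sumℚ (λ w′ → e i * M (bot i w′) (bot i w))
        ≡⟨ cong₂ _+_ (M-top-bot i w) (sumℚ-*ˡ (e i) (λ w′ → M (bot i w′) (bot i w))) ⟩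
      c i + e i * sumℚ (λ w′ → M (bot i w′) (bot i w))
        ≡⟨ cong (λ s → c i + e i * s) (block-columnSum i w) ⟩
      c i + - (c i * β⁻¹) * β
        ≡⟨ solve 3 (λ x y b → x :+ :- (x :* y) :* b := x :- x :* (y :* b)) refl (c i) β⁻¹ β ⟩
      c i - c i * (β⁻¹ * β)
        ≡⟨ cong (λ z → c i - c i * z) (ℚP.*-inverseˡ β {{≢-nonZero β≢0}}) ⟩
      c i - c i * 1ℚ
        ≡⟨ solve 1 (λ x → x :- x :* con 1ℚ := con 0ℚ) refl (c i) ⟩
      0ℚ ∎
    byCase (no i≢l) = begin
      N (top i) (bot l w)
        ≡⟨ N-top i (bot l w) ⟩
      M (top i) (bot l w) + sumℚ (λ w′ → e i * M (bot i w′) (bot l w))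
        ≡⟨ cong₂ _+_ (M-top-bot-≢ i l w i≢l)
                     (sumℚ-zero _ (λ w′ → trans (cong (e i *_) (M-bot-bot-≢ i l w′ w i≢l)) (ℚP.*-zeroʳ (e i)))) ⟩
      0ℚ + 0ℚ
        ≡⟨⟩
      0ℚ ∎

  N-upperRight : ∀ i q → N (top i) (n ↑ʳ q) ≡ 0ℚ
  N-upperRight i q = trans (cong (N (top i) ∘ (n ↑ʳ_)) (sym (combine-remQuot {n} m q))) (N-upperRight-block i _ _)

  N-upperLeft : ∀ i j → N (top i) (top j) ≡ charMatrix (A G) α′ i j
  N-upperLeft i j = byCase (i ≟ j)
    where
    open ≡-Reasoning
    byCase : Dec (i ≡ j) → N (top i) (top j) ≡ charMatrix (A G) α′ i j
    byCase (yes refl) = begin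
      N (top i) (top i)
        ≡⟨ N-top i (top i) ⟩
      M (top i) (top i) + sumℚ (λ w → e i * M (bot i w) (top i))
        ≡⟨ cong₂ _+_ (M-top-top i) (trans (sumℚ-cong (λ w → cong (e i *_) (M-bot-top i w))) (sumℚ-const m (e i * c i))) ⟩
      α - ι (+ deg G i) - ι (+ m) + ι (+ m) * (e i * c i)
        ≡⟨ cong (λ z → α - ι (+ deg G i) - ι (+ m) + ι (+ m) * z) (e*c≡-β⁻¹ i) ⟩
      α - ι (+ deg G i) - ι (+ m) + ι (+ m) * - β⁻¹
        ≡⟨ solve 4 (λ a x y b → a :- x :- y :+ y :* :- b := a :- y :- y :* b :- x) refl α (ι (+ deg G i)) (ι (+ m)) β⁻¹ ⟩
      α′ - ι (+ deg G i)
        ≡⟨ charMatrix-diag (A G) α′ i (noLoops G i) ⟨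
      charMatrix (A G) α′ i i ∎
    byCase (no i≢j) = begin
      N (top i) (top j)
        ≡⟨ N-top i (top j) ⟩
      M (top i) (top j) + sumℚ (λ w → e i * M (bot i w) (top j))
        ≡⟨ cong₂ _+_ (M-top-top-≢ i j i≢j)
                     (sumℚ-zero _ (λ w → trans (cong (e i *_) (M-bot-top-≢ j i w (i≢j ∘ sym))) (ℚP.*-zeroʳ (e i)))) ⟩
      ι (A G i j) + 0ℚ
        ≡⟨ ℚP.+-identityʳ (ι (A G i j)) ⟩
      ι (A G i j)
        ≡⟨ charMatrix-offDiag (A G) α′ i j i≢j ⟨
      charMatrix (A G) α′ i j ∎

mainTheorem19 : (n m : ℕ) (G : SignedGraph n) (H : Fin n → SignedGraph m)
    (r : ℕ) (k : ℤ) → (∀ l → CoRegular (H l) r k) →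
    (d : ℕ) → (∀ l w → deg⁻ (H l) w ≡ d) →
    (α : ℚ) → (nz : α - 1ℚ - ((+ 2 / 1) * (+ d / 1)) ≢ 0ℚ) →
    charLM (coronaA G H) α
      ≡ prodℚ (λ l → charL (H l) (α - 1ℚ))
        * charL G (α - (+ m / 1)
                     - _÷_ (+ m / 1) (α - 1ℚ - ((+ 2 / 1) * (+ d / 1))) {{≢-nonZero nz}})
mainTheorem19 n m G H _ _ _ d deg⁻≡d α β≢0 = begin
  charLM C α
    ≡⟨ charLM≡det C α ⟩
  det M
    ≡⟨ det-addToTopRows n M N combine (λ i _ → e i) N-top N-bot ⟨
  det N
    ≡⟨ det-blockTriangular n N N-upperRight ⟩
  det (λ i j → N (top i) (top j)) * det (λ q q′ → N (n ↑ʳ q) (n ↑ʳ q′))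
    ≡⟨ cong₂ _*_ (det-cong N-upperLeft) (det-cong (λ q q′ → N-bot q (n ↑ʳ q′))) ⟩
  det (charMatrix (A G) α′) * det (λ q q′ → M (n ↑ʳ q) (n ↑ʳ q′))
    ≡⟨ cong (det (charMatrix (A G) α′) *_) (det-blockDiagonal n _ M-bot-bot-≢) ⟩
  det (charMatrix (A G) α′) * prodℚ (λ l → det (λ w w′ → M (bot l w) (bot l w′)))
    ≡⟨ cong₂ _*_ (sym (charLM≡det (A G) α′))
                 (prodℚ-cong (λ l → trans (det-cong (M-bot-bot l)) (sym (charLM≡det (A (H l)) (α - 1ℚ))))) ⟩
  charL G α′ * prodℚ (λ l → charL (H l) (α - 1ℚ))
    ≡⟨ ℚP.*-comm (charL G α′) (prodℚ (λ l → charL (H l) (α - 1ℚ))) ⟩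
  prodℚ (λ l → charL (H l) (α - 1ℚ)) * charL G α′ ∎
  where
  open ≡-Reasoning
  open CoronaDeterminant G H d deg⁻≡d α β≢0
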